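{- Let $w=(w_0,\dots,w_l)\in\mathbb{Z}^+\times\mathbb{N}^l$ with $l\ge 2$ and $w_0\ge\cdots\ge w_l$. For a graph $G$ of order at least three, $\gamma_{(w_0,\dots,w_l)}(G)=2$ if and only if one of the following holds: (i) $w_2=0$, $\gamma(G)=1$, and either $w_0=2$ or $w_0=w_1=1$; (ii) $w_0=1$, $w_1=0$ and $\gamma(G)=2$; (iii) $w_0=1$, $w_1=1$ and $\gamma_t(G)=2$; (iv) $w_0=2$, $w_1=0$ and $\gamma_2(G)=2$; (v) $w_0=2$, $w_1=1$ and $\gamma_{\times2}(G)=2$.
   Context: All graphs are finite and simple; $N(v)$ is the open neighbourhood, $N[v]=N(v)\cup\{v\}$, and $f(S)=\sum_{u\in S}f(u)$. $\mathbb{Z}^+=\{1,2,\dots\}$, $\mathbb{N}=\mathbb{Z}^+\cup\{0\}$. For $w=(w_0,\dots,w_l)$ with nonnegative integer entries and $w_0\ge 1$, a function $f:V(G)\to\{0,\dots,l\}$ is $w$-dominating if $f(N(v))\ge w_i$ for every $v$ with $f(v)=i$; $\gamma_w(G)$ is the minimum of $\sum_v f(v)$ over $w$-dominating functions. $\gamma(G)$ is the domination number; $\gamma_t(G)$ is the total domination number (minimum size of a set $D$ such that every vertex has a neighbour in $D$); $\gamma_2(G)$ is the 2-domination number (minimum size of $D$ such that every vertex outside $D$ has at least two neighbours in $D$); $\gamma_{\times2}(G)$ is the double domination number (minimum size of $D$ with $|N[v]\cap D|\ge2$ for every vertex $v$). -}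

module Defs where

open import Data.Nat using (ℕ; zero; suc; _+_; _≤_)
open import Data.Bool using (Bool; true; false; if_then_else_)
open import Data.Fin using (Fin; toℕ)
import Data.Fin as Fin
open import Data.Fin.Subset using (Subset; _∈_; _∉_; _∩_; _∪_; ⁅_⁆; ∣_∣)
open import Data.Vec using (tabulate)
open import Data.Product using (Σ; ∃; _×_)
open import Relation.Binary.PropositionalEquality using (_≡_)

record Graph : Set where
  field
    n     : ℕ
    adj   : Fin n → Fin n → Bool
    sym   : ∀ u v → adj u v ≡ adj v u
    irrefl : ∀ v → adj v v ≡ false
open Graph public

N : (G : Graph) → Fin (n G) → Subset (n G)
N G v = tabulate (adj G v)

N[_] : (G : Graph) → Fin (n G) → Subset (n G)
N[ G ] v = N G v ∪ ⁅ v ⁆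

sumFin : (m : ℕ) → (Fin m → ℕ) → ℕ
sumFin zero    g = 0
sumFin (suc m) g = g Fin.zero + sumFin m (λ i → g (Fin.suc i))

MinIs : (ℕ → Set) → ℕ → Set
MinIs P k = P k × (∀ m → P m → k ≤ m)

weight : (G : Graph) {l : ℕ} → (Fin (n G) → Fin (suc l)) → ℕ
weight G f = sumFin (n G) (λ u → toℕ (f u))

nbrWeight : (G : Graph) {l : ℕ} → (Fin (n G) → Fin (suc l)) → Fin (n G) → ℕ
nbrWeight G f v = sumFin (n G) (λ u → if adj G v u then toℕ (f u) else 0)

IsWDom : (G : Graph) {l : ℕ} → (Fin (suc l) → ℕ) → (Fin (n G) → Fin (suc l)) → Set
IsWDom G w f = ∀ v → w (f v) ≤ nbrWeight G f v

γw≡ : (G : Graph) {l : ℕ} → (Fin (suc l) → ℕ) → ℕ → Set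
γw≡ G {l} w k = MinIs (λ m → Σ (Fin (n G) → Fin (suc l)) λ f → IsWDom G w f × weight G f ≡ m) k

IsDominating IsTotalDominating Is2Dominating IsDoubleDominating :
  (G : Graph) → Subset (n G) → Set
IsDominating G D = ∀ v → 1 ≤ ∣ N[ G ] v ∩ D ∣
IsTotalDominating G D = ∀ v → 1 ≤ ∣ N G v ∩ D ∣
Is2Dominating G D = ∀ v → v ∉ D → 2 ≤ ∣ N G v ∩ D ∣
IsDoubleDominating G D = ∀ v → 2 ≤ ∣ N[ G ] v ∩ D ∣

setParam≡ : (G : Graph) → (Subset (n G) → Set) → ℕ → Set
setParam≡ G P k = MinIs (λ m → Σ (Subset (n G)) λ D → P D × ∣ D ∣ ≡ m) k

γ≡ γt≡ γ₂≡ γ×₂≡ : Graph → ℕ → Set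
γ≡ G = setParam≡ G (IsDominating G)
γt≡ G = setParam≡ G (IsTotalDominating G)
γ₂≡ G = setParam≡ G (Is2Dominating G)
γ×₂≡ G = setParam≡ G (IsDoubleDominating G)

-- Let f be a w-dominating function of weight 2 = γ_w(G). If f(u) = 2 for some vertex u, then f
-- vanishes elsewhere, so f(N(v)) is 2 or 0 according as v is adjacent to u or not: u dominates G,
-- w₂ = 0 and w₀ ≤ 2. Otherwise f is the indicator of a 2-set D, and w-domination of an indicator
-- only involves w₀ (for vertices outside D) and w₁ (inside D); since 1 ≤ w₀ ≤ 2 and w₁ ≤ 1 here,
-- the four possible pairs (w₀, w₁) turn it into domination, total domination, 2-domination and
-- double domination. Minimality is the same in both directions: a w-dominating function of weight
-- at most 1 exists exactly when w₀ = 1, w₁ = 0 and G has a dominating vertex.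
module Submission where

open import Defs hiding (sym)
open import Data.Nat using (ℕ; _≤_; suc)
open import Data.Fin using (Fin; zero)
import Data.Fin as F
open import Data.Product using (_×_)
open import Data.Sum using (_⊎_)
open import Function.Bundles using (_⇔_)
open import Relation.Binary.PropositionalEquality using (_≡_)

open import Data.Bool using (Bool; true; false; if_then_else_; _∧_)
open import Data.Bool.Properties using (if-float; if-eta; if-∧; if-cong; if-cong-then)
open import Data.Fin using (suc; toℕ; fromℕ<; _≟_)
open import Data.Fin.Properties using (suc-injective; toℕ-injective; any?)
open import Data.Fin.Subset
  using (Subset; inside; outside; ⁅_⁆; _∩_; _∪_; ∣_∣; _∈_; _∉_; Nonempty)
open import Data.Fin.Subset.Properties
  using (_∈?_; nonempty?; Empty-unique; ∣⊥∣≡0; ∣∁p∣≡n∸∣p∣; x∈∁p⇒x∉p; ∪-identityʳ; ∣p∩q∣≤∣q∣;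
         x∈p∩q⁺; x∈⁅x⁆; x∉⁅y⁆⇒x≢y; ∣⁅x⁆∣≡1; x∈p⇒∣p-x∣<∣p∣)
open import Data.Nat using (zero; _+_; _<_; _≤?_; _<?_; z≤n; s≤s)
open import Data.Nat.Properties
  using (≤-refl; ≤-trans; ≤-reflexive; ≤-antisym; ≤-pred; +-comm; +-assoc; +-identityʳ; +-mono-≤;
         +-monoʳ-≤; +-cancelˡ-≤; m≤m+n; m≤n+m; m+n≤o⇒m≤o; n≤0⇒n≡0; n<1⇒n≡0; ≰⇒>; ≮⇒≥; m<n⇒0<n∸m;
         module ≤-Reasoning)
open import Data.Product using (Σ; ∃; ∃-syntax; _,_; proj₁; proj₂)
open import Data.Sum using (inj₁; inj₂)
open import Data.Vec using (_∷_; []; lookup; tabulate; here; there)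
open import Data.Vec.Properties using (lookup-zipWith; lookup∘tabulate; []=⇒lookup; lookup⇒[]=)
open import Function using (_∘_; case_of_)
open import Function.Bundles using (mk⇔; Equivalence)
open import Relation.Binary.PropositionalEquality
  using (refl; sym; trans; cong; cong₂; subst; subst₂; _≢_; _≗_)
open import Relation.Nullary using (¬_; yes; no; does; contradiction)
open import Relation.Nullary.Decidable using (dec-true; dec-false)

open Equivalence using (to; from)

-- Finite sums

sumFin-cong : ∀ {m} {g h : Fin m → ℕ} → g ≗ h → sumFin m g ≡ sumFin m h
sumFin-cong {zero} _ = refl
sumFin-cong {suc m} g≗h = cong₂ _+_ (g≗h zero) (sumFin-cong (g≗h ∘ suc))

sumFin-mono : ∀ {m} {g h : Fin m → ℕ} → (∀ i → g i ≤ h i) → sumFin m g ≤ sumFin m h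
sumFin-mono {zero} _ = z≤n
sumFin-mono {suc m} g≤h = +-mono-≤ (g≤h zero) (sumFin-mono (g≤h ∘ suc))

sumFin-zero : ∀ {m} (h : Fin m → ℕ) → (∀ i → h i ≡ 0) → sumFin m h ≡ 0
sumFin-zero {zero} _ _ = refl
sumFin-zero {suc m} h h≡0 = cong₂ _+_ (h≡0 zero) (sumFin-zero (h ∘ suc) (h≡0 ∘ suc))

term≤sumFin : ∀ {m} (h : Fin m → ℕ) (u : Fin m) → h u ≤ sumFin m h
term≤sumFin h zero = m≤m+n (h zero) _
term≤sumFin h (suc u) = ≤-trans (term≤sumFin (h ∘ suc) u) (m≤n+m _ (h zero))

two-terms≤sumFin : ∀ {m} (h : Fin m → ℕ) {u v : Fin m} → u ≢ v → h u + h v ≤ sumFin m h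
two-terms≤sumFin h {zero} {zero} u≢v = contradiction refl u≢v
two-terms≤sumFin h {zero} {suc v} _ = +-monoʳ-≤ (h zero) (term≤sumFin (h ∘ suc) v)
two-terms≤sumFin h {suc u} {zero} _ =
  subst (_≤ sumFin _ h) (+-comm (h zero) (h (suc u))) (+-monoʳ-≤ (h zero) (term≤sumFin (h ∘ suc) u))
two-terms≤sumFin h {suc u} {suc v} u≢v =
  ≤-trans (two-terms≤sumFin (h ∘ suc) (u≢v ∘ cong suc)) (m≤n+m _ (h zero))

sumFin-concentrated : ∀ {m} (h : Fin m → ℕ) (u : Fin m) →
                      (∀ x → x ≢ u → h x ≡ 0) → sumFin m h ≡ h u
sumFin-concentrated h zero h≡0 =
  trans (cong (h zero +_) (sumFin-zero (h ∘ suc) (λ x → h≡0 (suc x) λ ()))) (+-identityʳ (h zero))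
sumFin-concentrated h (suc u) h≡0 =
  cong₂ _+_ (h≡0 zero λ ())
            (sumFin-concentrated (h ∘ suc) u λ x x≢u → h≡0 (suc x) (x≢u ∘ suc-injective))

sumFin≤term⇒concentrated : ∀ {m} (h : Fin m → ℕ) (u : Fin m) →
                           sumFin m h ≤ h u → ∀ x → x ≢ u → h x ≡ 0
sumFin≤term⇒concentrated h u Σ≤hu x x≢u = n≤0⇒n≡0 (+-cancelˡ-≤ (h u) (h x) 0 (begin
  h u + h x   ≤⟨ two-terms≤sumFin h (x≢u ∘ sym) ⟩
  sumFin _ h  ≤⟨ Σ≤hu ⟩
  h u         ≡⟨ +-identityʳ (h u) ⟨
  h u + 0     ∎))
  where open ≤-Reasoning

sumFin-pos : ∀ {m} (h : Fin m → ℕ) → 1 ≤ sumFin m h → ∃[ i ] 1 ≤ h i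
sumFin-pos h 1≤Σ with any? (λ i → 1 ≤? h i)
... | yes found = found
... | no none = contradiction (subst (1 ≤_) (sumFin-zero h h≡0) 1≤Σ) λ ()
  where
  h≡0 : ∀ i → h i ≡ 0
  h≡0 i = n<1⇒n≡0 (≰⇒> λ 1≤hi → none (i , 1≤hi))

if-then-else-0≤ : ∀ b {a} → (if b then a else 0) ≤ a
if-then-else-0≤ true = ≤-refl
if-then-else-0≤ false = z≤n

sumFin-masked+term≤sumFin : ∀ {m} (b : Fin m → Bool) (h : Fin m → ℕ) {v} → b v ≡ false →
                            sumFin m (λ x → if b x then h x else 0) + h v ≤ sumFin m h
sumFin-masked+term≤sumFin b h {zero} b₀≡false rewrite b₀≡false =
  subst (_≤ sumFin _ h) (+-comm (h zero) _)
        (+-monoʳ-≤ (h zero) (sumFin-mono λ x → if-then-else-0≤ (b (suc x))))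
sumFin-masked+term≤sumFin b h {suc v} bv≡false =
  subst (_≤ sumFin _ h) (sym (+-assoc (if b zero then h zero else 0) _ (h (suc v))))
        (+-mono-≤ (if-then-else-0≤ (b zero)) (sumFin-masked+term≤sumFin (b ∘ suc) (h ∘ suc) bv≡false))

-- Counting in subsets

χ : ∀ {m} → Subset m → Fin m → ℕ
χ p x = if lookup p x then 1 else 0

lookup-∉ : ∀ {m} {p : Subset m} {x} → x ∉ p → lookup p x ≡ false
lookup-∉ {p = p} {x} x∉p with lookup p x in eq
... | true = contradiction (lookup⇒[]= x p eq) x∉p
... | false = refl

∣p∣≡sumFin-χ : ∀ {m} (p : Subset m) → ∣ p ∣ ≡ sumFin m (χ p)
∣p∣≡sumFin-χ [] = refl
∣p∣≡sumFin-χ (inside ∷ p) = cong suc (∣p∣≡sumFin-χ p)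
∣p∣≡sumFin-χ (outside ∷ p) = ∣p∣≡sumFin-χ p

∣tabulate∩q∣≡sumFin : ∀ {m} (b : Fin m → Bool) (q : Subset m) →
                      ∣ tabulate b ∩ q ∣ ≡ sumFin m (λ x → if b x then χ q x else 0)
∣tabulate∩q∣≡sumFin b q = trans (∣p∣≡sumFin-χ (tabulate b ∩ q)) (sumFin-cong χ-∩)
  where
  χ-∩ : ∀ x → χ (tabulate b ∩ q) x ≡ (if b x then χ q x else 0)
  χ-∩ x = trans (if-cong (trans (lookup-zipWith _ x (tabulate b) q)
                                (cong (_∧ lookup q x) (lookup∘tabulate b x))))
                (if-∧ (b x))

∣p∪⁅x⁆∩q∣≡∣p∩q∣+χ : ∀ {m} {x : Fin m} (p q : Subset m) → x ∉ p →
                    ∣ (p ∪ ⁅ x ⁆) ∩ q ∣ ≡ ∣ p ∩ q ∣ + χ q x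
∣p∪⁅x⁆∩q∣≡∣p∩q∣+χ {x = zero} (inside ∷ p) q x∉p = contradiction here x∉p
∣p∪⁅x⁆∩q∣≡∣p∩q∣+χ {x = zero} (outside ∷ p) (inside ∷ q) _ =
  trans (cong (λ r → suc ∣ r ∩ q ∣) (∪-identityʳ p)) (+-comm 1 ∣ p ∩ q ∣)
∣p∪⁅x⁆∩q∣≡∣p∩q∣+χ {x = zero} (outside ∷ p) (outside ∷ q) _ =
  trans (cong (λ r → ∣ r ∩ q ∣) (∪-identityʳ p)) (sym (+-identityʳ ∣ p ∩ q ∣))
∣p∪⁅x⁆∩q∣≡∣p∩q∣+χ {x = suc x} (outside ∷ p) (_ ∷ q) x∉p =
  ∣p∪⁅x⁆∩q∣≡∣p∩q∣+χ p q (x∉p ∘ there)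
∣p∪⁅x⁆∩q∣≡∣p∩q∣+χ {x = suc x} (inside ∷ p) (inside ∷ q) x∉p =
  cong suc (∣p∪⁅x⁆∩q∣≡∣p∩q∣+χ p q (x∉p ∘ there))
∣p∪⁅x⁆∩q∣≡∣p∩q∣+χ {x = suc x} (inside ∷ p) (outside ∷ q) x∉p =
  ∣p∪⁅x⁆∩q∣≡∣p∩q∣+χ p q (x∉p ∘ there)

∈⇒1≤∣p∣ : ∀ {m} {p : Subset m} {x} → x ∈ p → 1 ≤ ∣ p ∣
∈⇒1≤∣p∣ x∈p = ≤-trans (s≤s z≤n) (x∈p⇒∣p-x∣<∣p∣ x∈p)

1≤∣p∣⇒nonempty : ∀ {m} {p : Subset m} → 1 ≤ ∣ p ∣ → Nonempty p
1≤∣p∣⇒nonempty {m} {p} 1≤∣p∣ with nonempty? p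
... | yes ne = ne
... | no empty =
  contradiction (subst (1 ≤_) (trans (cong ∣_∣ (Empty-unique empty)) (∣⊥∣≡0 m)) 1≤∣p∣) λ ()

∣p∣<m⇒∃∉ : ∀ {m} {p : Subset m} → ∣ p ∣ < m → ∃[ x ] x ∉ p
∣p∣<m⇒∃∉ {m} {p} ∣p∣<m =
  let (x , x∈∁p) = 1≤∣p∣⇒nonempty (subst (1 ≤_) (sym (∣∁p∣≡n∸∣p∣ p)) (m<n⇒0<n∸m ∣p∣<m))
  in x , x∈∁p⇒x∉p x∈∁p

∃≢ : ∀ {m} → 2 ≤ m → (u : Fin m) → ∃[ x ] x ≢ u
∃≢ 2≤m u =
  let (x , x∉⁅u⁆) = ∣p∣<m⇒∃∉ (subst (_< _) (sym (∣⁅x⁆∣≡1 u)) 2≤m) in x , x∉⁅y⁆⇒x≢y x∉⁅u⁆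

-- Domination by sets

IsDominatingVertex : (G : Graph) → Fin (n G) → Set
IsDominatingVertex G u = ∀ x → x ≢ u → adj G x u ≡ true

-- the support of a {0,1}-valued (a, b, …)-dominating function
IsWeightedDominating : (G : Graph) → ℕ → ℕ → Subset (n G) → Set
IsWeightedDominating G a b D =
  ∀ v → (v ∉ D → a ≤ ∣ N G v ∩ D ∣) × (v ∈ D → b ≤ ∣ N G v ∩ D ∣)

-- for a ≥ 1 and at least two vertices, γ_(a, b, …)(G) ≤ 1 exactly in this case
Degenerate : ℕ → ℕ → Graph → Set
Degenerate a b G = a ≡ 1 × b ≡ 0 × ∃ (IsDominatingVertex G)

module _ (G : Graph) where

  v∉N : ∀ v → v ∉ N G v
  v∉N v v∈N = contradiction
    (trans (sym (irrefl G v)) (trans (sym (lookup∘tabulate (adj G v) v)) ([]=⇒lookup v∈N))) λ ()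

  adj⇒∈N : ∀ {v u} → adj G v u ≡ true → u ∈ N G v
  adj⇒∈N {v} {u} e = lookup⇒[]= u (N G v) (trans (lookup∘tabulate (adj G v) u) e)

  ∣N[v]∩D∣-∉ : ∀ {v D} → v ∉ D → ∣ N[ G ] v ∩ D ∣ ≡ ∣ N G v ∩ D ∣
  ∣N[v]∩D∣-∉ {v} {D} v∉D =
    trans (∣p∪⁅x⁆∩q∣≡∣p∩q∣+χ (N G v) D (v∉N v))
          (trans (cong (∣ N G v ∩ D ∣ +_) (if-cong (lookup-∉ v∉D))) (+-identityʳ _))

  ∣N[v]∩D∣-∈ : ∀ {v D} → v ∈ D → ∣ N[ G ] v ∩ D ∣ ≡ suc ∣ N G v ∩ D ∣
  ∣N[v]∩D∣-∈ {v} {D} v∈D =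
    trans (∣p∪⁅x⁆∩q∣≡∣p∩q∣+χ (N G v) D (v∉N v))
          (trans (cong (∣ N G v ∩ D ∣ +_) (if-cong ([]=⇒lookup v∈D))) (+-comm _ 1))

  IsDominating⇔ : ∀ {D} → IsDominating G D ⇔ IsWeightedDominating G 1 0 D
  IsDominating⇔ {D} = mk⇔
    (λ dom v → (λ v∉D → subst (1 ≤_) (∣N[v]∩D∣-∉ v∉D) (dom v)) , λ _ → z≤n)
    (λ wd v → case v ∈? D of λ where
      (yes v∈D) → subst (1 ≤_) (sym (∣N[v]∩D∣-∈ v∈D)) (s≤s z≤n)
      (no v∉D)  → subst (1 ≤_) (sym (∣N[v]∩D∣-∉ v∉D)) (proj₁ (wd v) v∉D))

  IsTotalDominating⇔ : ∀ {D} → IsTotalDominating G D ⇔ IsWeightedDominating G 1 1 D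
  IsTotalDominating⇔ {D} = mk⇔
    (λ tot v → (λ _ → tot v) , (λ _ → tot v))
    (λ wd v → case v ∈? D of λ where
      (yes v∈D) → proj₂ (wd v) v∈D
      (no v∉D)  → proj₁ (wd v) v∉D)

  Is2Dominating⇔ : ∀ {D} → Is2Dominating G D ⇔ IsWeightedDominating G 2 0 D
  Is2Dominating⇔ = mk⇔ (λ dom v → dom v , λ _ → z≤n) (λ wd v → proj₁ (wd v))

  IsDoubleDominating⇔ : ∀ {D} → IsDoubleDominating G D ⇔ IsWeightedDominating G 2 1 D
  IsDoubleDominating⇔ {D} = mk⇔
    (λ dbl v → (λ v∉D → subst (2 ≤_) (∣N[v]∩D∣-∉ v∉D) (dbl v))
             , (λ v∈D → ≤-pred (subst (2 ≤_) (∣N[v]∩D∣-∈ v∈D) (dbl v))))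
    (λ wd v → case v ∈? D of λ where
      (yes v∈D) → subst (2 ≤_) (sym (∣N[v]∩D∣-∈ v∈D)) (s≤s (proj₂ (wd v) v∈D))
      (no v∉D)  → subst (2 ≤_) (sym (∣N[v]∩D∣-∉ v∉D)) (proj₁ (wd v) v∉D))

  weightedDominating-∉⇒≤∣D∣ : ∀ {a b D v} → IsWeightedDominating G a b D → v ∉ D → a ≤ ∣ D ∣
  weightedDominating-∉⇒≤∣D∣ {D = D} {v} wd v∉D =
    ≤-trans (proj₁ (wd v) v∉D) (∣p∩q∣≤∣q∣ (N G v) D)

  weightedDominating-∈⇒<∣D∣ : ∀ {a b D v} → IsWeightedDominating G a b D → v ∈ D → b < ∣ D ∣
  weightedDominating-∈⇒<∣D∣ {D = D} {v} wd v∈D =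
    ≤-trans (s≤s (proj₂ (wd v) v∈D)) (subst (_≤ ∣ D ∣) (∣N[v]∩D∣-∈ v∈D) (∣p∩q∣≤∣q∣ (N[ G ] v) D))

  dominatingVertex⇒dominating : ∀ {u} → IsDominatingVertex G u → IsDominating G ⁅ u ⁆
  dominatingVertex⇒dominating {u} dom = from IsDominating⇔ λ v →
      (λ v∉⁅u⁆ → ∈⇒1≤∣p∣ (x∈p∩q⁺ (adj⇒∈N (dom v (x∉⁅y⁆⇒x≢y v∉⁅u⁆)) , x∈⁅x⁆ u)))
    , λ _ → z≤n

-- Weight functions

pointMass : ∀ {m l} → Fin (suc l) → Fin m → Fin m → Fin (suc l)
pointMass c u x = if does (x ≟ u) then c else zero

pointMass-at : ∀ {m l} (c : Fin (suc l)) (u : Fin m) → pointMass c u u ≡ c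
pointMass-at c u = if-cong (dec-true (u ≟ u) refl)

pointMass-off : ∀ {m l} (c : Fin (suc l)) {u x : Fin m} → x ≢ u → pointMass c u x ≡ zero
pointMass-off c {u} {x} x≢u = if-cong (dec-false (x ≟ u) x≢u)

indicator : ∀ {m l} → Subset m → Fin m → Fin (suc (suc l))
indicator D x = if lookup D x then suc zero else zero

indicator-∈ : ∀ {m l} {D : Subset m} {x} → x ∈ D → indicator {l = l} D x ≡ suc zero
indicator-∈ x∈D = if-cong ([]=⇒lookup x∈D)

indicator-∉ : ∀ {m l} {D : Subset m} {x} → x ∉ D → indicator {l = l} D x ≡ zero
indicator-∉ x∉D = if-cong (lookup-∉ x∉D)

toℕ-indicator : ∀ {m l} (D : Subset m) x → toℕ (indicator {l = l} D x) ≡ χ D x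
toℕ-indicator D x = if-float toℕ (lookup D x)

support : ∀ {m l} → (Fin m → Fin (suc l)) → Subset m
support f = tabulate (λ x → does (1 ≤? toℕ (f x)))

indicator-support : ∀ {m l} (f : Fin m → Fin (suc (suc l))) → (∀ x → toℕ (f x) ≤ 1) →
                    ∀ x → f x ≡ indicator (support f) x
indicator-support f f≤1 x
  rewrite lookup∘tabulate (λ y → does (1 ≤? toℕ (f y))) x with f x | f≤1 x
... | zero | _ = refl
... | suc zero | _ = refl
... | suc (suc _) | s≤s ()

module _ (G : Graph) {l : ℕ} where

  weight-cong : {f g : Fin (n G) → Fin (suc l)} → f ≗ g → weight G f ≡ weight G g
  weight-cong f≗g = sumFin-cong (cong toℕ ∘ f≗g)

  nbrWeight-cong : {f g : Fin (n G) → Fin (suc l)} → f ≗ g →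
                   ∀ v → nbrWeight G f v ≡ nbrWeight G g v
  nbrWeight-cong f≗g v = sumFin-cong λ u → if-cong-then (adj G v u) (cong toℕ (f≗g u))

  toℕ≤weight : ∀ (f : Fin (n G) → Fin (suc l)) u → toℕ (f u) ≤ weight G f
  toℕ≤weight f = term≤sumFin (toℕ ∘ f)

  nbrWeight+toℕ≤weight : ∀ (f : Fin (n G) → Fin (suc l)) v →
                         nbrWeight G f v + toℕ (f v) ≤ weight G f
  nbrWeight+toℕ≤weight f v = sumFin-masked+term≤sumFin (adj G v) (toℕ ∘ f) (irrefl G v)

  module _ {f : Fin (n G) → Fin (suc l)} {u : Fin (n G)}
           (off-u : ∀ x → x ≢ u → toℕ (f x) ≡ 0) where

    weight-concentrated : weight G f ≡ toℕ (f u)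
    weight-concentrated = sumFin-concentrated (toℕ ∘ f) u off-u

    nbrWeight-concentrated : ∀ v → nbrWeight G f v ≡ (if adj G v u then toℕ (f u) else 0)
    nbrWeight-concentrated v = sumFin-concentrated _ u λ x x≢u →
      trans (if-cong-then (adj G v x) (off-u x x≢u)) (if-eta (adj G v x))

  pointMass-concentrated : ∀ (c : Fin (suc l)) (u x : Fin (n G)) → x ≢ u → toℕ (pointMass c u x) ≡ 0
  pointMass-concentrated c u x x≢u = cong toℕ (pointMass-off c x≢u)

  weight-pointMass : ∀ (c : Fin (suc l)) (u : Fin (n G)) → weight G (pointMass c u) ≡ toℕ c
  weight-pointMass c u =
    trans (weight-concentrated (pointMass-concentrated c u)) (cong toℕ (pointMass-at c u))

  nbrWeight-pointMass : ∀ (c : Fin (suc l)) (u v : Fin (n G)) →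
                        nbrWeight G (pointMass c u) v ≡ (if adj G v u then toℕ c else 0)
  nbrWeight-pointMass c u v = trans (nbrWeight-concentrated (pointMass-concentrated c u) v)
                                    (if-cong-then (adj G v u) (cong toℕ (pointMass-at c u)))

  weight-indicator : ∀ (D : Subset (n G)) → weight G (indicator {l = l} D) ≡ ∣ D ∣
  weight-indicator D = trans (sumFin-cong (toℕ-indicator D)) (sym (∣p∣≡sumFin-χ D))

  nbrWeight-indicator : ∀ (D : Subset (n G)) v → nbrWeight G (indicator {l = l} D) v ≡ ∣ N G v ∩ D ∣
  nbrWeight-indicator D v = trans (sumFin-cong λ u → if-cong-then (adj G v u) (toℕ-indicator D u))
                                  (sym (∣tabulate∩q∣≡sumFin (adj G v) D))

1≤-if⇒ : ∀ b {a c} → 1 ≤ a → a ≤ (if b then c else 0) → b ≡ true × a ≤ c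
1≤-if⇒ true _ a≤c = refl , a≤c
1≤-if⇒ false 1≤a a≤0 = contradiction (≤-trans 1≤a a≤0) λ ()

module _ (G : Graph) {l : ℕ} (w : Fin (suc l) → ℕ) where

  IsWDom-resp-≗ : {f g : Fin (n G) → Fin (suc l)} → f ≗ g → IsWDom G w f → IsWDom G w g
  IsWDom-resp-≗ f≗g f-dom v = subst₂ (λ c k → w c ≤ k) (f≗g v) (nbrWeight-cong G f≗g v) (f-dom v)

  weight-pos : ∀ {f} → 1 ≤ w zero → 1 ≤ n G → IsWDom G w f → 1 ≤ weight G f
  weight-pos {f} w₀≥1 1≤n f-dom = at (fromℕ< 1≤n) refl
    where
    at : ∀ v {c} → f v ≡ c → 1 ≤ weight G f
    at v {zero} fv≡0 =
      ≤-trans w₀≥1 (≤-trans (subst (λ c → w c ≤ nbrWeight G f v) fv≡0 (f-dom v))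
                            (m+n≤o⇒m≤o (nbrWeight G f v) (nbrWeight+toℕ≤weight G f v)))
    at v {suc _} fv≡c =
      ≤-trans (s≤s z≤n) (subst (λ c → toℕ c ≤ weight G f) fv≡c (toℕ≤weight G f v))

  IsWDom-concentrated : ∀ {f u} → 1 ≤ w zero → IsWDom G w f → weight G f ≤ toℕ (f u) →
    w (f u) ≡ 0 × IsDominatingVertex G u × (2 ≤ n G → w zero ≤ toℕ (f u))
  IsWDom-concentrated {f} {u} w₀≥1 f-dom weight≤fu =
      w[fu]≡0
    , (λ x x≢u → proj₁ (at x x≢u))
    , λ 2≤n → let (x , x≢u) = ∃≢ 2≤n u in proj₂ (at x x≢u)
    where
    off-u : ∀ x → x ≢ u → toℕ (f x) ≡ 0
    off-u = sumFin≤term⇒concentrated (toℕ ∘ f) u weight≤fu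

    w[fu]≡0 : w (f u) ≡ 0
    w[fu]≡0 = n≤0⇒n≡0 (subst (w (f u) ≤_)
      (trans (nbrWeight-concentrated G off-u u) (if-cong (irrefl G u))) (f-dom u))

    at : ∀ x → x ≢ u → adj G x u ≡ true × w zero ≤ toℕ (f u)
    at x x≢u = 1≤-if⇒ (adj G x u) w₀≥1
      (subst₂ _≤_ (cong w (toℕ-injective (off-u x x≢u))) (nbrWeight-concentrated G off-u x) (f-dom x))

  pointMass-wdom : ∀ {c u} → IsDominatingVertex G u → w c ≡ 0 → w zero ≤ toℕ c →
                   IsWDom G w (pointMass c u)
  pointMass-wdom {c} {u} dom wc≡0 w₀≤c v with v ≟ u
  ... | yes refl = subst (_≤ _) (sym wc≡0) z≤n
  ... | no v≢u =
    subst (w zero ≤_) (sym (trans (nbrWeight-pointMass G c u v) (if-cong (dom v v≢u)))) w₀≤c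

module _ (G : Graph) {l : ℕ} (w : Fin (suc (suc l)) → ℕ) where

  indicator-wdom⇔ : ∀ {D} → IsWDom G w (indicator D) ⇔ IsWeightedDominating G (w zero) (w (suc zero)) D
  indicator-wdom⇔ {D} = mk⇔
    (λ wdom v → let at : ∀ {c} → indicator D v ≡ c → w c ≤ ∣ N G v ∩ D ∣
                    at = λ { refl → subst (w (indicator D v) ≤_) (nbrWeight-indicator G D v) (wdom v) }
                in (λ v∉D → at (indicator-∉ v∉D)) , (λ v∈D → at (indicator-∈ v∈D)))
    (λ wd v → subst (w (indicator D v) ≤_) (sym (nbrWeight-indicator G D v)) (case v ∈? D of λ where
      (yes v∈D) → subst (λ c → w c ≤ _) (sym (indicator-∈ v∈D)) (proj₂ (wd v) v∈D)
      (no v∉D)  → subst (λ c → w c ≤ _) (sym (indicator-∉ v∉D)) (proj₁ (wd v) v∉D)))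

  support-weightedDominating : ∀ {f} → (∀ x → toℕ (f x) ≤ 1) → IsWDom G w f →
    IsWeightedDominating G (w zero) (w (suc zero)) (support f) × ∣ support f ∣ ≡ weight G f
  support-weightedDominating {f} f≤1 f-dom =
      to indicator-wdom⇔ (IsWDom-resp-≗ G w f≗indicator f-dom)
    , trans (sym (weight-indicator G (support f))) (sym (weight-cong G f≗indicator))
    where f≗indicator = indicator-support f f≤1

-- Domination numbers

MinIs-intro : ∀ {A : Set} {P : A → Set} {size : A → ℕ} {k} (x : A) → P x → size x ≡ k →
              (∀ y → P y → k ≤ size y) → MinIs (λ m → Σ A λ y → P y × size y ≡ m) k
MinIs-intro x px size≡k lower = (x , px , size≡k) , λ { _ (y , py , refl) → lower y py }

MinIs-lower : ∀ {A : Set} {P : A → Set} {size : A → ℕ} {k} →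
              MinIs (λ m → Σ A λ y → P y × size y ≡ m) k → ∀ y → P y → k ≤ size y
MinIs-lower (_ , minimal) y py = minimal _ (y , py , refl)

module _ (G : Graph) where

  ∣D∣≡1⇒dominatingVertex : ∀ {D} → IsDominating G D → ∣ D ∣ ≡ 1 → ∃ (IsDominatingVertex G)
  ∣D∣≡1⇒dominatingVertex {D} dom ∣D∣≡1 =
    u , proj₁ (proj₂ (IsWDom-concentrated G w₁₀ (s≤s z≤n) wdom weight≤1))
    where
    -- γ(G) = γ_(1,0)(G)
    w₁₀ : Fin 2 → ℕ
    w₁₀ zero = 1
    w₁₀ (suc zero) = 0

    wdom : IsWDom G w₁₀ (indicator D)
    wdom = from (indicator-wdom⇔ G w₁₀) (to (IsDominating⇔ G) dom)

    D-nonempty : Nonempty D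
    D-nonempty = 1≤∣p∣⇒nonempty (≤-reflexive (sym ∣D∣≡1))

    u = proj₁ D-nonempty
    u∈D = proj₂ D-nonempty

    weight≤1 : weight G (indicator D) ≤ toℕ (indicator {l = 0} D u)
    weight≤1 = subst₂ _≤_ (sym (trans (weight-indicator G D) ∣D∣≡1))
                          (sym (cong toℕ (indicator-∈ u∈D))) ≤-refl

  dominating⇒1≤∣D∣ : ∀ {D} → Fin (n G) → IsDominating G D → 1 ≤ ∣ D ∣
  dominating⇒1≤∣D∣ {D} v dom = ≤-trans (dom v) (∣p∩q∣≤∣q∣ (N[ G ] v) D)

  dominating⇒2≤∣D∣ : ∀ {D} → Fin (n G) → ¬ ∃ (IsDominatingVertex G) → IsDominating G D → 2 ≤ ∣ D ∣
  dominating⇒2≤∣D∣ v no-dv dom = ≮⇒≥ λ ∣D∣<2 →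
    no-dv (∣D∣≡1⇒dominatingVertex dom (≤-antisym (≤-pred ∣D∣<2) (dominating⇒1≤∣D∣ v dom)))

  totalDominating⇒2≤∣D∣ : ∀ {D} → Fin (n G) → IsTotalDominating G D → 2 ≤ ∣ D ∣
  totalDominating⇒2≤∣D∣ {D} v tot =
    let (x , x∈D) = 1≤∣p∣⇒nonempty (≤-trans (tot v) (∣p∩q∣≤∣q∣ (N G v) D))
    in weightedDominating-∈⇒<∣D∣ G (to (IsTotalDominating⇔ G) tot) x∈D

  2Dominating⇒2≤∣D∣ : ∀ {D} → 2 ≤ n G → Is2Dominating G D → 2 ≤ ∣ D ∣
  2Dominating⇒2≤∣D∣ {D} 2≤n dom with ∣ D ∣ <? n G
  ... | yes ∣D∣<n = let (x , x∉D) = ∣p∣<m⇒∃∉ ∣D∣<n in ≤-trans (dom x x∉D) (∣p∩q∣≤∣q∣ (N G x) D)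
  ... | no ∣D∣≮n = ≤-trans 2≤n (≮⇒≥ ∣D∣≮n)

  doubleDominating⇒2≤∣D∣ : ∀ {D} → Fin (n G) → IsDoubleDominating G D → 2 ≤ ∣ D ∣
  doubleDominating⇒2≤∣D∣ {D} v dbl = ≤-trans (dbl v) (∣p∩q∣≤∣q∣ (N[ G ] v) D)

  dominatingVertex⇒γ≡1 : ∀ {u} → IsDominatingVertex G u → γ≡ G 1
  dominatingVertex⇒γ≡1 {u} dom =
    MinIs-intro ⁅ u ⁆ (dominatingVertex⇒dominating G dom) (∣⁅x⁆∣≡1 u) λ _ → dominating⇒1≤∣D∣ u

  γ≡1⇒dominatingVertex : γ≡ G 1 → ∃ (IsDominatingVertex G)
  γ≡1⇒dominatingVertex ((_ , dom , ∣D∣≡1) , _) = ∣D∣≡1⇒dominatingVertex dom ∣D∣≡1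

module _ (G : Graph) {l : ℕ} (w : Fin (suc (suc l)) → ℕ) (w₀≥1 : 1 ≤ w zero) (2≤n : 2 ≤ n G) where

  IsWDom-weight≤1 : ∀ {f} → IsWDom G w f → weight G f ≤ 1 → Degenerate (w zero) (w (suc zero)) G
  IsWDom-weight≤1 {f} f-dom weight≤1 =
      ≤-antisym (subst (w zero ≤_) fu≡1 (w₀≤fu 2≤n)) w₀≥1
    , subst (λ c → w c ≡ 0) (toℕ-injective fu≡1) w[fu]≡0
    , u , dom
    where
    f-support = sumFin-pos (toℕ ∘ f) (weight-pos G w w₀≥1 (≤-trans (s≤s z≤n) 2≤n) f-dom)
    u = proj₁ f-support
    1≤fu = proj₂ f-support

    fu≡1 : toℕ (f u) ≡ 1
    fu≡1 = ≤-antisym (≤-trans (toℕ≤weight G f u) weight≤1) 1≤fu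

    f-concentrated = IsWDom-concentrated G w w₀≥1 f-dom (≤-trans weight≤1 1≤fu)
    w[fu]≡0 = proj₁ f-concentrated
    dom = proj₁ (proj₂ f-concentrated)
    w₀≤fu = proj₂ (proj₂ f-concentrated)

  weights≥2⇔ : (∀ f → IsWDom G w f → 2 ≤ weight G f) ⇔ (¬ Degenerate (w zero) (w (suc zero)) G)
  weights≥2⇔ = mk⇔
    (λ { weights≥2 (w₀≡1 , w₁≡0 , u , dom) → contradiction
           (subst (2 ≤_) (weight-pointMass G (suc zero) u)
                         (weights≥2 _ (pointMass-wdom G w dom w₁≡0 (≤-reflexive w₀≡1))))
           λ { (s≤s ()) } })
    (λ nondeg f f-dom → ≮⇒≥ λ weight<2 → nondeg (IsWDom-weight≤1 f-dom (≤-pred weight<2)))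

  γw≡2-intro : ∀ {f} → IsWDom G w f → weight G f ≡ 2 →
               ¬ Degenerate (w zero) (w (suc zero)) G → γw≡ G w 2
  γw≡2-intro {f} f-dom weight≡2 nondeg = MinIs-intro f f-dom weight≡2 (from weights≥2⇔ nondeg)

-- The classification

SetClassification : ℕ → ℕ → Graph → Set
SetClassification a b G =
    (a ≡ 1 × b ≡ 0 × γ≡ G 2)
  ⊎ (a ≡ 1 × b ≡ 1 × γt≡ G 2)
  ⊎ (a ≡ 2 × b ≡ 0 × γ₂≡ G 2)
  ⊎ (a ≡ 2 × b ≡ 1 × γ×₂≡ G 2)

Classification : ∀ {k} → (Fin (suc (suc (suc k))) → ℕ) → Graph → Set
Classification w G =
    (w (suc (suc zero)) ≡ 0 × γ≡ G 1 × (w zero ≡ 2 ⊎ (w zero ≡ 1 × w (suc zero) ≡ 1)))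
  ⊎ SetClassification (w zero) (w (suc zero)) G

case-i-weights⇔ : ∀ {a b} → 1 ≤ a → b ≤ a →
                  (a ≡ 2 ⊎ (a ≡ 1 × b ≡ 1)) ⇔ (a ≤ 2 × ¬ (a ≡ 1 × b ≡ 0))
case-i-weights⇔ 1≤a b≤a = mk⇔
  (λ { (inj₁ refl) → ≤-refl , λ { (() , _) }
     ; (inj₂ (refl , refl)) → s≤s z≤n , λ { (_ , ()) } })
  (λ (a≤2 , ¬10) → by-values 1≤a a≤2 b≤a ¬10)
  where
  by-values : ∀ {a b} → 1 ≤ a → a ≤ 2 → b ≤ a → ¬ (a ≡ 1 × b ≡ 0) → a ≡ 2 ⊎ (a ≡ 1 × b ≡ 1)
  by-values {1} {0} _ _ _ ¬10 = contradiction (refl , refl) ¬10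
  by-values {1} {1} _ _ _ _ = inj₂ (refl , refl)
  by-values {2} _ _ _ _ = inj₁ refl
  by-values {1} {suc (suc _)} _ _ (s≤s ()) _
  by-values {suc (suc (suc _))} _ (s≤s (s≤s ())) _ _

module _ (G : Graph) where

  setClassification⇒weightedDominating : ∀ {a b} → SetClassification a b G →
    ∃[ D ] IsWeightedDominating G a b D × ∣ D ∣ ≡ 2 × ¬ Degenerate a b G
  setClassification⇒weightedDominating (inj₁ (refl , refl , γ≡2@((D , dom , ∣D∣≡2) , _))) =
    D , to (IsDominating⇔ G) dom , ∣D∣≡2 , λ { (_ , _ , u , dv) → contradiction
      (subst (2 ≤_) (∣⁅x⁆∣≡1 u) (MinIs-lower γ≡2 ⁅ u ⁆ (dominatingVertex⇒dominating G dv)))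
      λ { (s≤s ()) } }
  setClassification⇒weightedDominating (inj₂ (inj₁ (refl , refl , (D , tot , ∣D∣≡2) , _))) =
    D , to (IsTotalDominating⇔ G) tot , ∣D∣≡2 , λ { (_ , () , _) }
  setClassification⇒weightedDominating (inj₂ (inj₂ (inj₁ (refl , refl , (D , dom , ∣D∣≡2) , _)))) =
    D , to (Is2Dominating⇔ G) dom , ∣D∣≡2 , λ { (() , _) }
  setClassification⇒weightedDominating (inj₂ (inj₂ (inj₂ (refl , refl , (D , dbl , ∣D∣≡2) , _)))) =
    D , to (IsDoubleDominating⇔ G) dbl , ∣D∣≡2 , λ { (() , _) }

  weightedDominating⇒setClassification : ∀ {a b D} → 3 ≤ n G → 1 ≤ a →
    IsWeightedDominating G a b D → ∣ D ∣ ≡ 2 → ¬ Degenerate a b G → SetClassification a b G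
  weightedDominating⇒setClassification {a} {b} {D} 3≤n 1≤a wd ∣D∣≡2 nondeg =
    by-values 1≤a a≤2 b<2 wd nondeg
    where
    v₀ : Fin (n G)
    v₀ = fromℕ< (≤-trans (s≤s z≤n) 3≤n)

    a≤2 : a ≤ 2
    a≤2 = subst (a ≤_) ∣D∣≡2 (weightedDominating-∉⇒≤∣D∣ G wd
            (proj₂ (∣p∣<m⇒∃∉ (subst (_< n G) (sym ∣D∣≡2) 3≤n))))

    b<2 : b < 2
    b<2 = subst (b <_) ∣D∣≡2 (weightedDominating-∈⇒<∣D∣ G wd
            (proj₂ (1≤∣p∣⇒nonempty (subst (1 ≤_) (sym ∣D∣≡2) (s≤s z≤n)))))

    size-2 : ∀ {P} → P D → (∀ D′ → P D′ → 2 ≤ ∣ D′ ∣) → setParam≡ G P 2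
    size-2 pD = MinIs-intro D pD ∣D∣≡2

    by-values : ∀ {a b} → 1 ≤ a → a ≤ 2 → b < 2 → IsWeightedDominating G a b D →
                ¬ Degenerate a b G → SetClassification a b G
    by-values {1} {0} _ _ _ wd nondeg = inj₁ (refl , refl ,
      size-2 (from (IsDominating⇔ G) wd) λ _ → dominating⇒2≤∣D∣ G v₀ λ dv → nondeg (refl , refl , dv))
    by-values {1} {1} _ _ _ wd _ = inj₂ (inj₁ (refl , refl ,
      size-2 (from (IsTotalDominating⇔ G) wd) λ _ → totalDominating⇒2≤∣D∣ G v₀))
    by-values {2} {0} _ _ _ wd _ = inj₂ (inj₂ (inj₁ (refl , refl ,
      size-2 (from (Is2Dominating⇔ G) wd) λ _ → 2Dominating⇒2≤∣D∣ G (≤-trans (s≤s (s≤s z≤n)) 3≤n))))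
    by-values {2} {1} _ _ _ wd _ = inj₂ (inj₂ (inj₂ (refl , refl ,
      size-2 (from (IsDoubleDominating⇔ G) wd) λ _ → doubleDominating⇒2≤∣D∣ G v₀)))
    by-values {_} {suc (suc _)} _ _ (s≤s (s≤s ())) _ _
    by-values {suc (suc (suc _))} _ (s≤s (s≤s ())) _ _ _

module _ (G : Graph) {k : ℕ} (w : Fin (suc (suc (suc k))) → ℕ) (w₀≥1 : 1 ≤ w zero)
         (w₁≤w₀ : w (suc zero) ≤ w zero) where

  concentrated⇒case-i : ∀ {f u} → 2 ≤ n G → IsWDom G w f → weight G f ≡ 2 → 2 ≤ toℕ (f u) →
    ¬ Degenerate (w zero) (w (suc zero)) G →
    w (suc (suc zero)) ≡ 0 × γ≡ G 1 × (w zero ≡ 2 ⊎ (w zero ≡ 1 × w (suc zero) ≡ 1))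
  concentrated⇒case-i {f} {u} 2≤n f-dom weight≡2 2≤fu nondeg =
      subst (λ c → w c ≡ 0) (toℕ-injective fu≡2) (proj₁ f-concentrated)
    , dominatingVertex⇒γ≡1 G dom
    , from (case-i-weights⇔ w₀≥1 w₁≤w₀)
        ( subst (w zero ≤_) fu≡2 (proj₂ (proj₂ f-concentrated) 2≤n)
        , λ (w₀≡1 , w₁≡0) → nondeg (w₀≡1 , w₁≡0 , u , dom))
    where
    fu≡2 : toℕ (f u) ≡ 2
    fu≡2 = ≤-antisym (subst (toℕ (f u) ≤_) weight≡2 (toℕ≤weight G f u)) 2≤fu

    f-concentrated = IsWDom-concentrated G w w₀≥1 f-dom (subst (_≤ toℕ (f u)) (sym weight≡2) 2≤fu)
    dom = proj₁ (proj₂ f-concentrated)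

  γw≡2⇒classification : ∀ {f} → 3 ≤ n G → IsWDom G w f → weight G f ≡ 2 →
    ¬ Degenerate (w zero) (w (suc zero)) G → Classification w G
  γw≡2⇒classification {f} 3≤n f-dom weight≡2 nondeg with any? (λ u → 2 ≤? toℕ (f u))
  ... | yes (u , 2≤fu) =
    inj₁ (concentrated⇒case-i (≤-trans (s≤s (s≤s z≤n)) 3≤n) f-dom weight≡2 2≤fu nondeg)
  ... | no no-big =
    let f≤1 = λ u → ≤-pred (≰⇒> λ 2≤fu → no-big (u , 2≤fu))
        (wd , ∣D∣≡weight) = support-weightedDominating G w f≤1 f-dom
    in inj₂ (weightedDominating⇒setClassification G 3≤n w₀≥1 wd (trans ∣D∣≡weight weight≡2) nondeg)

  classification⇒γw≡2 : 2 ≤ n G → Classification w G → γw≡ G w 2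
  classification⇒γw≡2 2≤n (inj₁ (w₂≡0 , γ≡1 , w₀-case)) =
    let (u , dom) = γ≡1⇒dominatingVertex G γ≡1
        (w₀≤2 , ¬10) = to (case-i-weights⇔ w₀≥1 w₁≤w₀) w₀-case
    in γw≡2-intro G w w₀≥1 2≤n (pointMass-wdom G w dom w₂≡0 w₀≤2)
                                (weight-pointMass G (suc (suc zero)) u)
                                λ (w₀≡1 , w₁≡0 , _) → ¬10 (w₀≡1 , w₁≡0)
  classification⇒γw≡2 2≤n (inj₂ set-case) =
    let (D , wd , ∣D∣≡2 , nondeg) = setClassification⇒weightedDominating G set-case
    in γw≡2-intro G w w₀≥1 2≤n (from (indicator-wdom⇔ G w) wd)
                                (trans (weight-indicator G D) ∣D∣≡2) nondeg

theorem3p9 : (k : ℕ) (w : Fin (suc (suc (suc k))) → ℕ) →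
    1 ≤ w zero →
    (∀ i j → i F.≤ j → w j ≤ w i) →
    (G : Graph) → 3 ≤ n G →
    γw≡ G w 2 ⇔
      ((w (F.suc (F.suc zero)) ≡ 0 × γ≡ G 1 × (w zero ≡ 2 ⊎ (w zero ≡ 1 × w (F.suc zero) ≡ 1)))
      ⊎ (w zero ≡ 1 × w (F.suc zero) ≡ 0 × γ≡ G 2)
      ⊎ (w zero ≡ 1 × w (F.suc zero) ≡ 1 × γt≡ G 2)
      ⊎ (w zero ≡ 2 × w (F.suc zero) ≡ 0 × γ₂≡ G 2)
      ⊎ (w zero ≡ 2 × w (F.suc zero) ≡ 1 × γ×₂≡ G 2))
theorem3p9 k w w₀≥1 antitone G 3≤n = mk⇔
  (λ γw≡2@((_ , f-dom , weight≡2) , _) →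
     γw≡2⇒classification G w w₀≥1 w₁≤w₀ 3≤n f-dom weight≡2
       (to (weights≥2⇔ G w w₀≥1 2≤n) (MinIs-lower γw≡2)))
  (classification⇒γw≡2 G w w₀≥1 w₁≤w₀ 2≤n)
  where
  w₁≤w₀ : w (F.suc zero) ≤ w zero
  w₁≤w₀ = antitone zero (F.suc zero) z≤n

  2≤n : 2 ≤ n G
  2≤n = ≤-trans (s≤s (s≤s z≤n)) 3≤n
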